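{- Let $B\ge 3$ be odd, $d=(B+1)/2$, and $r$ an integer with $1\le r<B/2$. Let $S=\{d+x: x\in\langle r\rangle\}$ where $\langle r\rangle$ is the cyclic subgroup of $\mathbb{Z}_d$ generated by $r$, and let $A(B,r)_S$ be the principal submatrix of $A(B,r)$ indexed by $S$. Then $r$ is an eigenvalue of $A(B,r)_S$, and $A(B,r)_S$ has an entrywise positive left eigenvector corresponding to $r$.
   Context: $A(B,r)$ is the $d\times d$ real matrix whose rows and columns are indexed by $\{d,d+1,\dots,B\}$, with entries (all unspecified entries are $0$): row $d$: $A_{d,d}=-d$, $A_{d,B+1-r}=2(B+1-r)$, and $A_{d,k}=k$ for $B+1-r<k\le B$; for $d<k\le d+r-1$: $A_{k,k}=-k$ and $A_{k,d+k-r}=d+k-r$; for $d+r\le k\le B$: $A_{k,k}=-k$ and $A_{k,k-r}=k-r$. -}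

module Defs where

open import Data.Bool using (Bool; true; false; if_then_else_; _∧_)
open import Data.Nat as ℕ using (ℕ; zero; suc; _≡ᵇ_; _<ᵇ_; _≤ᵇ_; _∸_; _%_; _/_)
open import Data.Nat.Properties using (_≟_)
open import Data.Integer as ℤ using (ℤ; +_)
open import Data.Rational as ℚ using (ℚ; 0ℚ; _<_)
open import Data.List using (List; []; _∷_; map; filter; upTo; foldr)
open import Data.List.Membership.Propositional using (_∈_)
open import Data.List.Membership.DecPropositional _≟_ using (_∈?_)
open import Data.Product using (Σ; ∃; _×_)
open import Relation.Binary.PropositionalEquality using (_≡_; _≢_)

dOf : ℕ → ℕ
dOf B = suc B / 2

ι : ℤ → ℚ
ι n = n ℚ./ 1

-- The matrix A(B,r), rows/columns indexed by {d,…,B} ⊆ ℕ; entries outside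
-- the specified ones (including outside the index range) are 0.
A : (B r : ℕ) → ℕ → ℕ → ℚ
A B r i j =
  if i ≡ᵇ d then
    (if j ≡ᵇ d then ι (ℤ.- (+ d))
     else if j ≡ᵇ b1r then ι (+ (2 ℕ.* b1r))
     else if (b1r <ᵇ j) ∧ (j ≤ᵇ B) then ι (+ j)
     else 0ℚ)
  else if (d <ᵇ i) ∧ (i ≤ᵇ d ℕ.+ r ∸ 1) then
    (if j ≡ᵇ i then ι (ℤ.- (+ i))
     else if j ≡ᵇ (d ℕ.+ i ∸ r) then ι (+ (d ℕ.+ i ∸ r))
     else 0ℚ)
  else if (d ℕ.+ r ≤ᵇ i) ∧ (i ≤ᵇ B) then
    (if j ≡ᵇ i then ι (ℤ.- (+ i))
     else if j ≡ᵇ (i ∸ r) then ι (+ (i ∸ r))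
     else 0ℚ)
  else 0ℚ
  where
    d = dOf B
    b1r = suc B ∸ r

-- The cyclic subgroup ⟨r⟩ of ℤ_d, elements represented by 0,…,d-1:
-- all residues (k·r mod d) for k = 0,…,d-1 (d ≥ 1).
cyclicSub : (d r : ℕ) .{{_ : ℕ.NonZero d}} → List ℕ
cyclicSub d r = map (λ k → (k ℕ.* r) % d) (upTo d)

-- S = { d + x : x ∈ ⟨r⟩ }, listed without repetition in increasing order.
Sidx : (B r : ℕ) → List ℕ
Sidx B r with dOf B
... | zero = []
... | suc d' = map (suc d' ℕ.+_) (filter (λ x → x ∈? cyclicSub (suc d') r) (upTo (suc d')))

sumOver : List ℕ → (ℕ → ℚ) → ℚ
sumOver I f = foldr (λ i acc → f i ℚ.+ acc) 0ℚ I

-- For a matrix M whose rows/cols are labelled by ℕ, the principal submatrix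
-- indexed by the (repetition-free) list I is M restricted to I × I.
-- Vectors indexed by I are functions ℕ → ℚ (only values on I matter).

IsEigenvalue : (I : List ℕ) (M : ℕ → ℕ → ℚ) (λ₀ : ℚ) → Set
IsEigenvalue I M λ₀ =
  Σ (ℕ → ℚ) λ v →
    (Σ ℕ λ j → j ∈ I × v j ≢ 0ℚ) ×
    (∀ i → i ∈ I → sumOver I (λ j → M i j ℚ.* v j) ≡ λ₀ ℚ.* v i)

IsPosLeftEigenvector : (I : List ℕ) (M : ℕ → ℕ → ℚ) (λ₀ : ℚ) (w : ℕ → ℚ) → Set
IsPosLeftEigenvector I M λ₀ w =
  (∀ i → i ∈ I → 0ℚ < w i) ×
  (∀ j → j ∈ I → sumOver I (λ i → w i ℚ.* M i j) ≡ λ₀ ℚ.* w j)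

-- Write the indices d, …, B of A(B,r) as d + x with x ∈ ℤ_d, so that d = r + e and B + 1 = 2d.
-- Row d + x of A has -(d + x) on the diagonal and d + s x in column d + s x, where s x = x - r
-- in ℤ_d; row d carries in addition d + y in every column d + y with y ≥ e.  As ⟨r⟩ is closed
-- under x ↦ x ± r, the submatrix on S has the same shape.  The positive vector w(d + x) = d + x
-- is a left eigenvector for r: column d + y of w A_S is (d + y)(-(d + y) + (d + t y) + [y ≥ e] d)
-- with t y = y + r in ℤ_d, and the bracket is r both for y < e (t y = y + r) and for y ≥ e
-- (t y = y - e).  A right eigenvector v solves the rows x ≠ 0, (d + x + r) v x = (d + s x) v (s x),
-- recursively along the s-orbit from v 0 = 1; the remaining row d then holds because
-- w (A v) = (w A) v = r (w v) and w d ≠ 0.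

module Submission where

open import Defs
open import Data.Nat using (ℕ; suc; _*_; _≤_; _<_)
open import Data.Integer using (+_)
open import Data.Rational using (ℚ)
open import Data.Product using (Σ; _×_)
open import Relation.Binary.PropositionalEquality using (_≡_)

open import Algebra.Bundles using (CommutativeMonoid)
import Algebra.Properties.CommutativeSemigroup as CommutativeSemigroupProperties
import Algebra.Properties.Group as GroupProperties
open import Data.Bool using (Bool; true; false; if_then_else_; _∧_)
open import Data.Bool.Properties using (if-cong; if-cong-else; ∧-identityʳ)
open import Data.Integer as ℤ using ()
import Data.Integer.Properties as ℤP
open import Data.List using (List; []; _∷_; map; filter; upTo)
open import Data.List.Membership.Propositional using (_∈_)
open import Data.List.Membership.Propositional.Properties
  using (∈-map⁺; ∈-map⁻; ∈-filter⁺; ∈-filter⁻; ∈-upTo⁺; ∈-upTo⁻)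
open import Data.List.Properties using (foldr-map)
import Data.List.Relation.Unary.All as All
open import Data.List.Relation.Unary.AllPairs using (_∷_)
open import Data.List.Relation.Unary.Any using (here; there)
open import Data.List.Relation.Unary.Unique.Propositional using (Unique)
import Data.List.Relation.Unary.Unique.Propositional.Properties as Unique
open import Data.Nat as ℕ using (zero; _+_; _∸_; _%_; _≡ᵇ_; _<ᵇ_; _≤ᵇ_; s≤s; z≤n)
open import Data.Nat.Coprimality as Coprime using (1-coprimeTo)
open import Data.Nat.DivMod using (%-distribˡ-+; m%n%n≡m%n; [m+n]%n≡m%n; m<n⇒m%n≡m; m%n<n; m*n%n≡0; m*n/n≡m)
open import Data.Nat.GeneralisedArithmetic using (iterate)
open import Data.Nat.Properties
open import Data.Nat.Tactic.RingSolver using (solve-∀)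
open import Data.List.Membership.DecPropositional _≟_ using (_∈?_)
open import Data.Product using (∃-syntax; _,_; proj₂)
open import Data.Rational as ℚ using (mkℚ; 0ℚ; 1ℚ; 1/_; _÷_)
import Data.Rational.Properties as ℚP
open import Data.Rational.Solver using (module +-*-Solver)
open import Data.Sum using ([_,_]′)
open import Function.Bundles using (mk⇔)
open import Relation.Binary.Definitions using (tri<; tri≈; tri>)
open import Relation.Binary.PropositionalEquality
open import Relation.Nullary using (¬_; yes; no; contradiction)
open import Relation.Nullary.Decidable using (dec-true; dec-false; does-⇔; toSum)

open +-*-Solver using (solve; _:=_; _:+_; _:*_; :-_)
open ≡-Reasoning

private
  module ℚ+ = GroupProperties ℚP.+-0-group
  module ℚ+ᶜ = CommutativeSemigroupProperties (CommutativeMonoid.commutativeSemigroup ℚP.+-0-commutativeMonoid)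

ι⁺ : ℕ → ℚ
ι⁺ n = ι (+ n)

-- ι⁺ n is not a literal (normalisation goes through gcd); this form exposes sign and denominator.
ι⁺≡mkℚ : ∀ n → ι⁺ n ≡ mkℚ (+ n) 0 (Coprime.sym (1-coprimeTo n))
ι⁺≡mkℚ n = ℚP.normalize-coprime (Coprime.sym (1-coprimeTo n))

ι⁺-+ : ∀ m n → ι⁺ (m + n) ≡ ι⁺ m ℚ.+ ι⁺ n
ι⁺-+ m n = begin
  ι (+ m ℤ.+ + n)                  ≡⟨ cong ι (cong₂ ℤ._+_ (ℤP.*-identityʳ (+ m)) (ℤP.*-identityʳ (+ n))) ⟨
  ι (+ m ℤ.* + 1 ℤ.+ + n ℤ.* + 1)  ≡⟨ cong₂ ℚ._+_ (ι⁺≡mkℚ m) (ι⁺≡mkℚ n) ⟨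
  ι⁺ m ℚ.+ ι⁺ n                    ∎

ι-neg : ∀ n → ι (ℤ.- (+ n)) ≡ ℚ.- ι⁺ n
ι-neg zero    = refl
ι-neg (suc n) = refl

ι⁺-pos : ∀ n → 0ℚ ℚ.< ι⁺ (suc n)
ι⁺-pos n = subst (0ℚ ℚ.<_) (sym (ι⁺≡mkℚ (suc n))) (ℚP.positive⁻¹ _)

ι⁺-nonZero : ∀ n → ℚ.NonZero (ι⁺ (suc n))
ι⁺-nonZero n = ℚ.>-nonZero (ι⁺-pos n)

infix 8 [_]·_
[_]·_ : Bool → ℚ → ℚ
[ b ]· a = if b then a else 0ℚ

[]·-*ˡ : ∀ c b a → c ℚ.* [ b ]· a ≡ [ b ]· (c ℚ.* a)
[]·-*ˡ c true  a = refl
[]·-*ˡ c false a = ℚP.*-zeroʳ c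

[]·-*ʳ : ∀ b a c → [ b ]· a ℚ.* c ≡ [ b ]· (a ℚ.* c)
[]·-*ʳ true  a c = refl
[]·-*ʳ false a c = ℚP.*-zeroˡ c

*-cancelˡ-nonZero : ∀ a {b c} .{{_ : ℚ.NonZero a}} → a ℚ.* b ≡ a ℚ.* c → b ≡ c
*-cancelˡ-nonZero a {b} {c} ab≡ac =
  trans (sym (1/a*[a*x]≡x b)) (trans (cong (1/ a ℚ.*_) ab≡ac) (1/a*[a*x]≡x c))
  where
  1/a*[a*x]≡x : ∀ x → 1/ a ℚ.* (a ℚ.* x) ≡ x
  1/a*[a*x]≡x x = begin
    1/ a ℚ.* (a ℚ.* x)  ≡⟨ ℚP.*-assoc (1/ a) a x ⟨
    1/ a ℚ.* a ℚ.* x    ≡⟨ cong (ℚ._* x) (ℚP.*-inverseˡ a) ⟩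
    1ℚ ℚ.* x            ≡⟨ ℚP.*-identityˡ x ⟩
    x                   ∎

*-÷-cancel : ∀ a b c .{{_ : ℚ.NonZero b}} → b ℚ.* ((a ÷ b) ℚ.* c) ≡ a ℚ.* c
*-÷-cancel a b c = begin
  b ℚ.* ((a ℚ.* 1/ b) ℚ.* c)
    ≡⟨ solve 4 (λ a b b⁻¹ c → b :* ((a :* b⁻¹) :* c) := (b :* b⁻¹) :* (a :* c)) refl a b (1/ b) c ⟩
  (b ℚ.* 1/ b) ℚ.* (a ℚ.* c)  ≡⟨ cong (ℚ._* (a ℚ.* c)) (ℚP.*-inverseʳ b) ⟩
  1ℚ ℚ.* (a ℚ.* c)            ≡⟨ ℚP.*-identityˡ (a ℚ.* c) ⟩
  a ℚ.* c                     ∎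

sumOver-cong : ∀ I {f g : ℕ → ℚ} → (∀ i → i ∈ I → f i ≡ g i) → sumOver I f ≡ sumOver I g
sumOver-cong []      f≗g = refl
sumOver-cong (x ∷ I) f≗g = cong₂ ℚ._+_ (f≗g x (here refl)) (sumOver-cong I (λ i i∈I → f≗g i (there i∈I)))

sumOver-*ˡ : ∀ I c (f : ℕ → ℚ) → sumOver I (λ i → c ℚ.* f i) ≡ c ℚ.* sumOver I f
sumOver-*ˡ []      c f = sym (ℚP.*-zeroʳ c)
sumOver-*ˡ (x ∷ I) c f = begin
  c ℚ.* f x ℚ.+ sumOver I (λ i → c ℚ.* f i)  ≡⟨ cong (c ℚ.* f x ℚ.+_) (sumOver-*ˡ I c f) ⟩
  c ℚ.* f x ℚ.+ c ℚ.* sumOver I f            ≡⟨ ℚP.*-distribˡ-+ c (f x) (sumOver I f) ⟨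
  c ℚ.* (f x ℚ.+ sumOver I f)                ∎

sumOver-*ʳ : ∀ I (f : ℕ → ℚ) c → sumOver I (λ i → f i ℚ.* c) ≡ sumOver I f ℚ.* c
sumOver-*ʳ I f c = begin
  sumOver I (λ i → f i ℚ.* c)  ≡⟨ sumOver-cong I (λ i _ → ℚP.*-comm (f i) c) ⟩
  sumOver I (λ i → c ℚ.* f i)  ≡⟨ sumOver-*ˡ I c f ⟩
  c ℚ.* sumOver I f            ≡⟨ ℚP.*-comm c (sumOver I f) ⟩
  sumOver I f ℚ.* c            ∎

sumOver-+ : ∀ I (f g : ℕ → ℚ) → sumOver I (λ i → f i ℚ.+ g i) ≡ sumOver I f ℚ.+ sumOver I g
sumOver-+ []      f g = refl
sumOver-+ (x ∷ I) f g = begin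
  (f x ℚ.+ g x) ℚ.+ sumOver I (λ i → f i ℚ.+ g i)  ≡⟨ cong ((f x ℚ.+ g x) ℚ.+_) (sumOver-+ I f g) ⟩
  (f x ℚ.+ g x) ℚ.+ (sumOver I f ℚ.+ sumOver I g)  ≡⟨ ℚ+ᶜ.interchange (f x) (g x) (sumOver I f) (sumOver I g) ⟩
  (f x ℚ.+ sumOver I f) ℚ.+ (g x ℚ.+ sumOver I g)  ∎

sumOver-vanishing : ∀ I {f : ℕ → ℚ} → (∀ i → i ∈ I → f i ≡ 0ℚ) → sumOver I f ≡ 0ℚ
sumOver-vanishing []      f≡0 = refl
sumOver-vanishing (x ∷ I) f≡0 =
  cong₂ ℚ._+_ (f≡0 x (here refl)) (sumOver-vanishing I (λ i i∈I → f≡0 i (there i∈I)))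

sumOver-swap : ∀ I J (f : ℕ → ℕ → ℚ) →
  sumOver I (λ i → sumOver J (f i)) ≡ sumOver J (λ j → sumOver I (λ i → f i j))
sumOver-swap []      J f = sym (sumOver-vanishing J (λ _ _ → refl))
sumOver-swap (x ∷ I) J f = begin
  sumOver J (f x) ℚ.+ sumOver I (λ i → sumOver J (f i))          ≡⟨ cong (sumOver J (f x) ℚ.+_) (sumOver-swap I J f) ⟩
  sumOver J (f x) ℚ.+ sumOver J (λ j → sumOver I (λ i → f i j))  ≡⟨ sumOver-+ J (f x) (λ j → sumOver I (λ i → f i j)) ⟨
  sumOver J (λ j → f x j ℚ.+ sumOver I (λ i → f i j))            ∎

sumOver-map : ∀ (g : ℕ → ℕ) I (f : ℕ → ℚ) → sumOver (map g I) f ≡ sumOver I (λ x → f (g x))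
sumOver-map g I f = foldr-map _ g 0ℚ I

sumOver-bilinear : ∀ I J (w : ℕ → ℚ) (M : ℕ → ℕ → ℚ) (v : ℕ → ℚ) →
  sumOver I (λ i → w i ℚ.* sumOver J (λ j → M i j ℚ.* v j)) ≡ sumOver J (λ j → sumOver I (λ i → w i ℚ.* M i j) ℚ.* v j)
sumOver-bilinear I J w M v = begin
  sumOver I (λ i → w i ℚ.* sumOver J (λ j → M i j ℚ.* v j))
    ≡⟨ sumOver-cong I (λ i _ → sumOver-*ˡ J (w i) (λ j → M i j ℚ.* v j)) ⟨
  sumOver I (λ i → sumOver J (λ j → w i ℚ.* (M i j ℚ.* v j)))
    ≡⟨ sumOver-swap I J (λ i j → w i ℚ.* (M i j ℚ.* v j)) ⟩
  sumOver J (λ j → sumOver I (λ i → w i ℚ.* (M i j ℚ.* v j)))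
    ≡⟨ sumOver-cong J (λ j _ → sumOver-cong I (λ i _ → ℚP.*-assoc (w i) (M i j) (v j))) ⟨
  sumOver J (λ j → sumOver I (λ i → w i ℚ.* M i j ℚ.* v j))
    ≡⟨ sumOver-cong J (λ j _ → sumOver-*ʳ I (λ i → w i ℚ.* M i j) (v j)) ⟩
  sumOver J (λ j → sumOver I (λ i → w i ℚ.* M i j) ℚ.* v j)
    ∎

module _ {I : List ℕ} (I-unique : Unique I) {p : ℕ} (p∈I : p ∈ I) where

  sumOver-single : ∀ {f : ℕ → ℚ} → (∀ i → i ∈ I → i ≢ p → f i ≡ 0ℚ) → sumOver I f ≡ f p
  sumOver-single = go I-unique p∈I
    where
    go : ∀ {I f} → Unique I → p ∈ I → (∀ i → i ∈ I → i ≢ p → f i ≡ 0ℚ) → sumOver I f ≡ f p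
    go {x ∷ I} {f} (x∉I ∷ _) (here refl) f≡0 = begin
      f x ℚ.+ sumOver I f  ≡⟨ cong (f x ℚ.+_) (sumOver-vanishing I (λ i i∈I → f≡0 i (there i∈I) (≢-sym (All.lookup x∉I i∈I)))) ⟩
      f x ℚ.+ 0ℚ           ≡⟨ ℚP.+-identityʳ (f x) ⟩
      f x                  ∎
    go {x ∷ I} {f} (x∉I ∷ I-unique) (there p∈I) f≡0 = begin
      f x ℚ.+ sumOver I f  ≡⟨ cong₂ ℚ._+_ (f≡0 x (here refl) (All.lookup x∉I p∈I)) (go I-unique p∈I (λ i i∈I → f≡0 i (there i∈I))) ⟩
      0ℚ ℚ.+ f p           ≡⟨ ℚP.+-identityˡ (f p) ⟩
      f p                  ∎

  sumOver-indicator : ∀ (f : ℕ → ℚ) → sumOver I (λ i → [ i ≡ᵇ p ]· f i) ≡ f p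
  sumOver-indicator f = trans (sumOver-single (λ i _ i≢p → cong (λ b → [ b ]· f i) (dec-false (i ≟ p) i≢p)))
                              (cong (λ b → [ b ]· f p) (dec-true (p ≟ p) refl))

  sumOver-agree-except : ∀ {f g : ℕ → ℚ} → (∀ i → i ∈ I → i ≢ p → f i ≡ g i) → sumOver I f ≡ sumOver I g → f p ≡ g p
  sumOver-agree-except = go I-unique p∈I
    where
    go : ∀ {I f g} → Unique I → p ∈ I → (∀ i → i ∈ I → i ≢ p → f i ≡ g i) → sumOver I f ≡ sumOver I g → f p ≡ g p
    go {x ∷ I} {f} {g} (x∉I ∷ _) (here refl) f≗g Σf≡Σg =
      ℚ+.∙-cancelʳ (sumOver I f) (f x) (g x) (trans Σf≡Σg (cong (g x ℚ.+_) (sym rest)))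
      where
      rest : sumOver I f ≡ sumOver I g
      rest = sumOver-cong I (λ i i∈I → f≗g i (there i∈I) (≢-sym (All.lookup x∉I i∈I)))
    go {x ∷ I} {f} {g} (x∉I ∷ I-unique) (there p∈I) f≗g Σf≡Σg =
      go I-unique p∈I (λ i i∈I → f≗g i (there i∈I))
        (ℚ+.∙-cancelˡ (f x) (sumOver I f) (sumOver I g)
          (trans Σf≡Σg (cong (ℚ._+ sumOver I g) (sym (f≗g x (here refl) (All.lookup x∉I p∈I))))))

  eigen-row-from-left-eigenvector :
    ∀ {M : ℕ → ℕ → ℚ} {λ₀ : ℚ} {w v : ℕ → ℚ} .{{_ : ℚ.NonZero (w p)}} →
    (∀ j → j ∈ I → sumOver I (λ i → w i ℚ.* M i j) ≡ λ₀ ℚ.* w j) →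
    (∀ i → i ∈ I → i ≢ p → sumOver I (λ j → M i j ℚ.* v j) ≡ λ₀ ℚ.* v i) →
    sumOver I (λ j → M p j ℚ.* v j) ≡ λ₀ ℚ.* v p
  eigen-row-from-left-eigenvector {M} {λ₀} {w} {v} wM≡λw Mv≡λv =
    *-cancelˡ-nonZero (w p) (sumOver-agree-except (λ i i∈I i≢p → cong (w i ℚ.*_) (Mv≡λv i i∈I i≢p)) w·Mv≡w·λv)
    where
    w·Mv≡w·λv : sumOver I (λ i → w i ℚ.* sumOver I (λ j → M i j ℚ.* v j)) ≡ sumOver I (λ i → w i ℚ.* (λ₀ ℚ.* v i))
    w·Mv≡w·λv = begin
      sumOver I (λ i → w i ℚ.* sumOver I (λ j → M i j ℚ.* v j))
        ≡⟨ sumOver-bilinear I I w M v ⟩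
      sumOver I (λ j → sumOver I (λ i → w i ℚ.* M i j) ℚ.* v j)
        ≡⟨ sumOver-cong I (λ j j∈I → cong (ℚ._* v j) (wM≡λw j j∈I)) ⟩
      sumOver I (λ j → λ₀ ℚ.* w j ℚ.* v j)
        ≡⟨ sumOver-cong I (λ j _ → solve 3 (λ l a b → l :* a :* b := a :* (l :* b)) refl λ₀ (w j) (v j)) ⟩
      sumOver I (λ i → w i ℚ.* (λ₀ ℚ.* v i))
        ∎

sumOver-shift : ∀ k J (f : ℕ → ℕ → ℚ) → sumOver (map (k ℕ.+_) J) (λ j → f j (j ∸ k)) ≡ sumOver J (λ y → f (k + y) y)
sumOver-shift k J f = begin
  sumOver (map (k ℕ.+_) J) (λ j → f j (j ∸ k))  ≡⟨ sumOver-map (k ℕ.+_) J (λ j → f j (j ∸ k)) ⟩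
  sumOver J (λ y → f (k + y) (k + y ∸ k))       ≡⟨ sumOver-cong J (λ y _ → cong (f (k + y)) (m+n∸m≡n k y)) ⟩
  sumOver J (λ y → f (k + y) y)                 ∎

module _ (k : ℕ) {J : List ℕ} {M : ℕ → ℕ → ℚ} {λ₀ : ℚ} where

  IsEigenvalue-shift : IsEigenvalue J (λ x y → M (k + x) (k + y)) λ₀ → IsEigenvalue (map (k ℕ.+_) J) M λ₀
  IsEigenvalue-shift (v , (y , y∈J , vy≢0) , Mv≡λv) =
    (λ i → v (i ∸ k)) , (k + y , ∈-map⁺ (k ℕ.+_) y∈J , subst (λ z → v z ≢ 0ℚ) (sym (m+n∸m≡n k y)) vy≢0) , rows
    where
    rows : ∀ i → i ∈ map (k ℕ.+_) J → sumOver (map (k ℕ.+_) J) (λ j → M i j ℚ.* v (j ∸ k)) ≡ λ₀ ℚ.* v (i ∸ k)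
    rows i i∈ with x , x∈J , refl ← ∈-map⁻ (k ℕ.+_) i∈ = begin
      sumOver (map (k ℕ.+_) J) (λ j → M (k + x) j ℚ.* v (j ∸ k))  ≡⟨ sumOver-shift k J (λ j y → M (k + x) j ℚ.* v y) ⟩
      sumOver J (λ y → M (k + x) (k + y) ℚ.* v y)                  ≡⟨ Mv≡λv x x∈J ⟩
      λ₀ ℚ.* v x                                                   ≡⟨ cong (λ z → λ₀ ℚ.* v z) (m+n∸m≡n k x) ⟨
      λ₀ ℚ.* v (k + x ∸ k)                                         ∎

  IsPosLeftEigenvector-shift : ∀ {w} → IsPosLeftEigenvector J (λ x y → M (k + x) (k + y)) λ₀ w →
                               IsPosLeftEigenvector (map (k ℕ.+_) J) M λ₀ (λ i → w (i ∸ k))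
  IsPosLeftEigenvector-shift {w} (w>0 , wM≡λw) = positive , columns
    where
    positive : ∀ i → i ∈ map (k ℕ.+_) J → 0ℚ ℚ.< w (i ∸ k)
    positive i i∈ with x , x∈J , refl ← ∈-map⁻ (k ℕ.+_) i∈ = subst (λ z → 0ℚ ℚ.< w z) (sym (m+n∸m≡n k x)) (w>0 x x∈J)
    columns : ∀ j → j ∈ map (k ℕ.+_) J → sumOver (map (k ℕ.+_) J) (λ i → w (i ∸ k) ℚ.* M i j) ≡ λ₀ ℚ.* w (j ∸ k)
    columns j j∈ with y , y∈J , refl ← ∈-map⁻ (k ℕ.+_) j∈ = begin
      sumOver (map (k ℕ.+_) J) (λ i → w (i ∸ k) ℚ.* M i (k + y))  ≡⟨ sumOver-shift k J (λ i x → w x ℚ.* M i (k + y)) ⟩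
      sumOver J (λ x → w x ℚ.* M (k + x) (k + y))                  ≡⟨ wM≡λw y y∈J ⟩
      λ₀ ℚ.* w y                                                   ≡⟨ cong (λ z → λ₀ ℚ.* w z) (m+n∸m≡n k y) ⟨
      λ₀ ℚ.* w (k + y ∸ k)                                         ∎

module Walk (s : ℕ → ℕ) (g : ℕ → ℚ) where

  walk : ℕ → ℕ → ℚ
  walk zero    x = 1ℚ
  walk (suc f) x = if x ≡ᵇ 0 then 1ℚ else g x ℚ.* walk f (s x)

  walk-stable : ∀ n {f x} → iterate s x n ≡ 0 → n ≤ f → walk f x ≡ walk n x
  walk-stable zero    {zero}  refl _ = refl
  walk-stable zero    {suc f} refl _ = refl
  walk-stable (suc n) {suc f} {x} hits0 (s≤s n≤f) with x ≡ᵇ 0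
  ... | true  = refl
  ... | false = cong (g x ℚ.*_) (walk-stable n hits0 n≤f)

  walk-step : ∀ n {f x} → x ≢ 0 → iterate s x n ≡ 0 → n ≤ f → walk f x ≡ g x ℚ.* walk f (s x)
  walk-step zero    x≢0 x≡0 _ = contradiction x≡0 x≢0
  walk-step (suc n) {suc f} {x} x≢0 hits0 (s≤s n≤f) rewrite dec-false (x ≟ 0) x≢0 =
    cong (g x ℚ.*_) (trans (walk-stable n hits0 n≤f) (sym (walk-stable n hits0 (m≤n⇒m≤1+n n≤f))))

[m%d+n]%d≡[m+n]%d : ∀ m n d .{{_ : ℕ.NonZero d}} → (m % d + n) % d ≡ (m + n) % d
[m%d+n]%d≡[m+n]%d m n d = begin
  (m % d + n) % d          ≡⟨ %-distribˡ-+ (m % d) n d ⟩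
  (m % d % d + n % d) % d  ≡⟨ cong (λ a → (a + n % d) % d) (m%n%n≡m%n m d) ⟩
  (m % d + n % d) % d      ≡⟨ %-distribˡ-+ m n d ⟨
  (m + n) % d              ∎

module Cyclic (r′ e : ℕ) where

  r d : ℕ
  r = suc r′
  d = r + e

  s t : ℕ → ℕ
  s x = (x + e) % d
  t y = (y + r) % d

  private
    add-both : ∀ a b x → a + b ≡ d → x < d → ((x + a) % d + b) % d ≡ x
    add-both a b x a+b≡d x<d = begin
      ((x + a) % d + b) % d  ≡⟨ [m%d+n]%d≡[m+n]%d (x + a) b d ⟩
      (x + a + b) % d        ≡⟨ cong (_% d) (trans (+-assoc x a b) (cong (x ℕ.+_) a+b≡d)) ⟩
      (x + d) % d            ≡⟨ [m+n]%n≡m%n x d ⟩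
      x % d                  ≡⟨ m<n⇒m%n≡m x<d ⟩
      x                      ∎

    wrap : ∀ a b z → a + b ≡ d → z < d → (a + z + b) % d ≡ z
    wrap a b z a+b≡d z<d = begin
      (a + z + b) % d  ≡⟨ cong (λ n → (n + b) % d) (+-comm a z) ⟩
      (z + a + b) % d  ≡⟨ cong (_% d) (trans (+-assoc z a b) (cong (z ℕ.+_) a+b≡d)) ⟩
      (z + d) % d      ≡⟨ [m+n]%n≡m%n z d ⟩
      z % d            ≡⟨ m<n⇒m%n≡m z<d ⟩
      z                ∎

  s∘t : ∀ {y} → y < d → s (t y) ≡ y
  s∘t {y} = add-both r e y refl

  t∘s : ∀ {x} → x < d → t (s x) ≡ x
  t∘s {x} = add-both e r x (+-comm e r)

  s-low : ∀ {x} → x < r → s x ≡ x + e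
  s-low x<r = m<n⇒m%n≡m (+-monoˡ-< e x<r)

  s-high : ∀ {x} → r ≤ x → x < d → s x ≡ x ∸ r
  s-high {x} r≤x x<d = begin
    (x + e) % d            ≡⟨ cong (λ n → (n + e) % d) (m+[n∸m]≡n r≤x) ⟨
    (r + (x ∸ r) + e) % d  ≡⟨ wrap r e (x ∸ r) refl (≤-<-trans (m∸n≤m x r) x<d) ⟩
    x ∸ r                  ∎

  t-low : ∀ {y} → y < e → t y ≡ y + r
  t-low {y} y<e = m<n⇒m%n≡m (subst (y + r <_) (+-comm e r) (+-monoˡ-< r y<e))

  t-high : ∀ {y} → e ≤ y → y < d → t y ≡ y ∸ e
  t-high {y} e≤y y<d = begin
    (y + r) % d            ≡⟨ cong (λ n → (n + r) % d) (m+[n∸m]≡n e≤y) ⟨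
    (e + (y ∸ e) + r) % d  ≡⟨ wrap e r (y ∸ e) (+-comm e r) (≤-<-trans (m∸n≤m y e) y<d) ⟩
    y ∸ e                  ∎

  ≡ᵇ-s-t : ∀ {x y} → x < d → y < d → (y ≡ᵇ s x) ≡ (x ≡ᵇ t y)
  ≡ᵇ-s-t {x} {y} x<d y<d = does-⇔ (mk⇔ (λ y≡sx → trans (sym (t∘s x<d)) (cong t (sym y≡sx)))
                                       (λ x≡ty → trans (sym (s∘t y<d)) (cong s (sym x≡ty))))
                                  (y ≟ s x) (x ≟ t y)

  multiple : ℕ → ℕ
  multiple n = n * r % d

  t-multiple : ∀ n → t (multiple n) ≡ multiple (suc n)
  t-multiple n = trans ([m%d+n]%d≡[m+n]%d (n * r) r d) (cong (_% d) (+-comm (n * r) r))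

  s-multiple : ∀ n → s (multiple (suc n)) ≡ multiple n
  s-multiple n = trans (cong s (sym (t-multiple n))) (s∘t (m%n<n (n * r) d))

  multiple-d : multiple d ≡ 0
  multiple-d = trans (cong (_% d) (*-comm d r)) (m*n%n≡0 r d)

  iterate-s-multiple : ∀ n → iterate s (multiple n) n ≡ 0
  iterate-s-multiple zero    = refl
  iterate-s-multiple (suc n) = trans (cong (λ x → iterate s x n) (s-multiple n)) (iterate-s-multiple n)

  InSubgroup : ℕ → Set
  InSubgroup x = ∃[ n ] n < d × x ≡ multiple n

  InSubgroup-0 : InSubgroup 0
  InSubgroup-0 = 0 , s≤s z≤n , refl

  InSubgroup⇒< : ∀ {x} → InSubgroup x → x < d
  InSubgroup⇒< (n , _ , refl) = m%n<n (n * r) d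

  InSubgroup-t : ∀ {x} → InSubgroup x → InSubgroup (t x)
  InSubgroup-t (n , n<d , refl) with suc n ≟ d
  ... | yes refl = 0 , s≤s z≤n , trans (t-multiple n) multiple-d
  ... | no 1+n≢d = suc n , ≤∧≢⇒< n<d 1+n≢d , t-multiple n

  InSubgroup-s : ∀ {x} → InSubgroup x → InSubgroup (s x)
  InSubgroup-s (zero  , _   , refl) = r′ + e , ≤-refl , trans (cong s (sym multiple-d)) (s-multiple (r′ + e))
  InSubgroup-s (suc n , n<d , refl) = n , <-trans (n<1+n n) n<d , s-multiple n

  subgroup : List ℕ
  subgroup = filter (_∈? cyclicSub d r) (upTo d)

  subgroup-unique : Unique subgroup
  subgroup-unique = Unique.filter⁺ (_∈? cyclicSub d r) (Unique.upTo⁺ d)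

  ∈-subgroup⁻ : ∀ {x} → x ∈ subgroup → InSubgroup x
  ∈-subgroup⁻ {x} x∈ with _ , x∈cyclic ← ∈-filter⁻ (_∈? cyclicSub d r) {xs = upTo d} x∈
                     with n , n∈ , refl ← ∈-map⁻ multiple {xs = upTo d} x∈cyclic = n , ∈-upTo⁻ n∈ , refl

  ∈-subgroup⁺ : ∀ {x} → InSubgroup x → x ∈ subgroup
  ∈-subgroup⁺ (n , n<d , refl) = ∈-filter⁺ (_∈? cyclicSub d r) (∈-upTo⁺ (m%n<n (n * r) d)) (∈-map⁺ multiple (∈-upTo⁺ n<d))

≡ᵇ-+ˡ : ∀ k m n → (k + m ≡ᵇ k + n) ≡ (m ≡ᵇ n)
≡ᵇ-+ˡ zero    m n = refl
≡ᵇ-+ˡ (suc k) m n = ≡ᵇ-+ˡ k m n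

≡ᵇ-sym : ∀ m n → (m ≡ᵇ n) ≡ (n ≡ᵇ m)
≡ᵇ-sym zero    zero    = refl
≡ᵇ-sym zero    (suc n) = refl
≡ᵇ-sym (suc m) zero    = refl
≡ᵇ-sym (suc m) (suc n) = ≡ᵇ-sym m n

<ᵇ-+ˡ : ∀ k m n → (k + m <ᵇ k + n) ≡ (m <ᵇ n)
<ᵇ-+ˡ zero    m n = refl
<ᵇ-+ˡ (suc k) m n = <ᵇ-+ˡ k m n

two-entry-row : ∀ {i k} j → i ≢ k →
  (if j ≡ᵇ i then ι (ℤ.- (+ i)) else if j ≡ᵇ k then ι⁺ k else 0ℚ) ≡ [ j ≡ᵇ i ]· (ℚ.- ι⁺ i) ℚ.+ [ j ≡ᵇ k ]· ι⁺ k
two-entry-row {i} {k} j i≢k with j ≟ i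
... | yes refl rewrite dec-true (j ≟ j) refl | dec-false (j ≟ k) i≢k = trans (ι-neg j) (sym (ℚP.+-identityʳ _))
... | no j≢i rewrite dec-false (j ≟ i) j≢i with j ≡ᵇ k
...   | true  = sym (ℚP.+-identityˡ (ι⁺ k))
...   | false = refl

module _ (d : ℕ) {e : ℕ} (y : ℕ) where

  private
    brackets : ∀ {c₀ cₑ c≤} → (y ≡ᵇ 0) ≡ c₀ → (y ≡ᵇ e) ≡ cₑ → (e ≤ᵇ y) ≡ c≤ →
      [ y ≡ᵇ 0 ]· (ℚ.- ι⁺ d) ℚ.+ [ y ≡ᵇ e ]· ι⁺ (d + e) ℚ.+ [ e ≤ᵇ y ]· ι⁺ (d + y)
      ≡ [ c₀ ]· (ℚ.- ι⁺ d) ℚ.+ [ cₑ ]· ι⁺ (d + e) ℚ.+ [ c≤ ]· ι⁺ (d + y)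
    brackets p q r = cong₂ ℚ._+_ (cong₂ ℚ._+_ (if-cong p) (if-cong q)) (if-cong r)

  head-row-offsets : 0 < e →
    (if y ≡ᵇ 0 then ι (ℤ.- (+ d)) else if y ≡ᵇ e then ι⁺ (2 * (d + e)) else if e <ᵇ y then ι⁺ (d + y) else 0ℚ)
    ≡ [ y ≡ᵇ 0 ]· (ℚ.- ι⁺ d) ℚ.+ [ y ≡ᵇ e ]· ι⁺ (d + e) ℚ.+ [ e ≤ᵇ y ]· ι⁺ (d + y)
  head-row-offsets e>0 with <-cmp e y
  ... | tri< e<y _ _ = begin
    (if y ≡ᵇ 0 then _ else if y ≡ᵇ e then _ else if e <ᵇ y then ι⁺ (d + y) else 0ℚ)
        ≡⟨ trans (if-cong y≢0) (trans (if-cong y≢e) (if-cong (dec-true (e <? y) e<y))) ⟩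
    ι⁺ (d + y)                     ≡⟨ ℚP.+-identityˡ (ι⁺ (d + y)) ⟨
    0ℚ ℚ.+ ι⁺ (d + y)              ≡⟨ cong (ℚ._+ ι⁺ (d + y)) (ℚP.+-identityˡ 0ℚ) ⟨
    0ℚ ℚ.+ 0ℚ ℚ.+ ι⁺ (d + y)       ≡⟨ brackets y≢0 y≢e (dec-true (e ≤? y) (<⇒≤ e<y)) ⟨
    _ ∎
    where
    y≢0 = dec-false (y ≟ 0) (>⇒≢ (<-trans e>0 e<y))
    y≢e = dec-false (y ≟ e) (>⇒≢ e<y)
  ... | tri≈ _ refl _ = begin
    (if y ≡ᵇ 0 then _ else if y ≡ᵇ y then ι⁺ (2 * (d + y)) else _)
        ≡⟨ trans (if-cong y≢0) (if-cong (dec-true (y ≟ y) refl)) ⟩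
    ι⁺ (2 * (d + y))                  ≡⟨ cong ι⁺ (cong (d + y ℕ.+_) (+-identityʳ (d + y))) ⟩
    ι⁺ (d + y + (d + y))              ≡⟨ ι⁺-+ (d + y) (d + y) ⟩
    ι⁺ (d + y) ℚ.+ ι⁺ (d + y)         ≡⟨ cong (ℚ._+ ι⁺ (d + y)) (ℚP.+-identityˡ (ι⁺ (d + y))) ⟨
    0ℚ ℚ.+ ι⁺ (d + y) ℚ.+ ι⁺ (d + y)  ≡⟨ brackets y≢0 (dec-true (y ≟ y) refl) (dec-true (y ≤? y) ≤-refl) ⟨
    _ ∎
    where
    y≢0 = dec-false (y ≟ 0) (>⇒≢ e>0)
  ... | tri> _ _ y<e = begin
    (if y ≡ᵇ 0 then ι (ℤ.- (+ d)) else if y ≡ᵇ e then _ else if e <ᵇ y then _ else 0ℚ)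
        ≡⟨ if-cong-else (y ≡ᵇ 0) (trans (if-cong y≢e) (if-cong (dec-false (e <? y) (<⇒≯ y<e)))) ⟩
    [ y ≡ᵇ 0 ]· ι (ℤ.- (+ d))                 ≡⟨ cong [ y ≡ᵇ 0 ]·_ (ι-neg d) ⟩
    [ y ≡ᵇ 0 ]· (ℚ.- ι⁺ d)                    ≡⟨ ℚP.+-identityʳ _ ⟨
    [ y ≡ᵇ 0 ]· (ℚ.- ι⁺ d) ℚ.+ 0ℚ             ≡⟨ ℚP.+-identityʳ _ ⟨
    [ y ≡ᵇ 0 ]· (ℚ.- ι⁺ d) ℚ.+ 0ℚ ℚ.+ 0ℚ      ≡⟨ brackets refl y≢e (dec-false (e ≤? y) (<⇒≱ y<e)) ⟨
    _ ∎
    where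
    y≢e = dec-false (y ≟ e) (<⇒≢ y<e)

eigen-balance : ∀ a b c ρ → b ℚ.+ c ≡ a ℚ.+ ρ → a ℚ.* ℚ.- a ℚ.+ b ℚ.* a ℚ.+ c ℚ.* a ≡ ρ ℚ.* a
eigen-balance a b c ρ b+c≡a+ρ = begin
  a ℚ.* ℚ.- a ℚ.+ b ℚ.* a ℚ.+ c ℚ.* a
    ≡⟨ solve 3 (λ a b c → a :* (:- a) :+ b :* a :+ c :* a := (b :+ c) :* a :+ :- (a :* a)) refl a b c ⟩
  (b ℚ.+ c) ℚ.* a ℚ.+ ℚ.- (a ℚ.* a)
    ≡⟨ cong (λ z → z ℚ.* a ℚ.+ ℚ.- (a ℚ.* a)) b+c≡a+ρ ⟩
  (a ℚ.+ ρ) ℚ.* a ℚ.+ ℚ.- (a ℚ.* a)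
    ≡⟨ solve 2 (λ a ρ → (a :+ ρ) :* a :+ :- (a :* a) := ρ :* a) refl a ρ ⟩
  ρ ℚ.* a
    ∎

dOf≡ : ∀ {B d} → suc B ≡ d + d → dOf B ≡ d
dOf≡ {B} {d} 1+B≡d+d = begin
  suc B ℕ./ 2    ≡⟨ cong (ℕ._/ 2) 1+B≡d+d ⟩
  (d + d) ℕ./ 2  ≡⟨ cong (ℕ._/ 2) (trans (cong (d ℕ.+_) (sym (+-identityʳ d))) (*-comm 2 d)) ⟩
  d * 2 ℕ./ 2    ≡⟨ m*n/n≡m d 2 ⟩
  d              ∎

Sidx≡ : ∀ {B r d′} → dOf B ≡ suc d′ →
  Sidx B r ≡ map (suc d′ ℕ.+_) (filter (_∈? cyclicSub (suc d′) r) (upTo (suc d′)))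
Sidx≡ dOfB≡1+d′ rewrite dOfB≡1+d′ = refl

module Submatrix (B r′ e : ℕ) (e>0 : 0 < e) (1+B≡d+d : suc B ≡ Cyclic.d r′ e + Cyclic.d r′ e) where

  open Cyclic r′ e

  dOfB≡d : dOf B ≡ d
  dOfB≡d = dOf≡ 1+B≡d+d

  d+y≤B : ∀ {y} → y < d → d + y ≤ B
  d+y≤B {y} y<d = ≤-pred (subst (d + y <_) (sym 1+B≡d+d) (+-monoʳ-< d y<d))

  1+B∸r≡d+e : suc B ∸ r ≡ d + e
  1+B∸r≡d+e = begin
    suc B ∸ r        ≡⟨ cong (_∸ r) 1+B≡d+d ⟩
    r + e + d ∸ r    ≡⟨ cong (_∸ r) (+-assoc r e d) ⟩
    r + (e + d) ∸ r  ≡⟨ m+n∸m≡n r (e + d) ⟩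
    e + d            ≡⟨ +-comm e d ⟩
    d + e            ∎

  A-head-row : ∀ {y} → y < d →
    A B r d (d + y) ≡ [ y ≡ᵇ 0 ]· (ℚ.- ι⁺ d) ℚ.+ [ y ≡ᵇ e ]· ι⁺ (d + e) ℚ.+ [ e ≤ᵇ y ]· ι⁺ (d + y)
  A-head-row {y} y<d = begin
    A B r d (d + y)
      ≡⟨ if-cong (dec-true (d ≟ dOf B) (sym dOfB≡d)) ⟩
    (if d + y ≡ᵇ dOf B then ι (ℤ.- (+ dOf B)) else if d + y ≡ᵇ suc B ∸ r then ι⁺ (2 * (suc B ∸ r))
     else if (suc B ∸ r <ᵇ d + y) ∧ (d + y ≤ᵇ B) then ι⁺ (d + y) else 0ℚ)
      ≡⟨ cong₂ (λ d₀ b → if d + y ≡ᵇ d₀ then ι (ℤ.- (+ d₀)) else if d + y ≡ᵇ b then ι⁺ (2 * b)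
                         else if (b <ᵇ d + y) ∧ (d + y ≤ᵇ B) then ι⁺ (d + y) else 0ℚ) dOfB≡d 1+B∸r≡d+e ⟩
    (if d + y ≡ᵇ d then ι (ℤ.- (+ d)) else if d + y ≡ᵇ d + e then ι⁺ (2 * (d + e))
     else if (d + e <ᵇ d + y) ∧ (d + y ≤ᵇ B) then ι⁺ (d + y) else 0ℚ)
      ≡⟨ if-cong is-d ⟩
    (if y ≡ᵇ 0 then ι (ℤ.- (+ d)) else if d + y ≡ᵇ d + e then ι⁺ (2 * (d + e))
     else if (d + e <ᵇ d + y) ∧ (d + y ≤ᵇ B) then ι⁺ (d + y) else 0ℚ)
      ≡⟨ if-cong-else (y ≡ᵇ 0) (trans (if-cong (≡ᵇ-+ˡ d y e)) (if-cong-else (y ≡ᵇ e) (if-cong beyond))) ⟩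
    (if y ≡ᵇ 0 then ι (ℤ.- (+ d)) else if y ≡ᵇ e then ι⁺ (2 * (d + e)) else if e <ᵇ y then ι⁺ (d + y) else 0ℚ)
      ≡⟨ head-row-offsets d y e>0 ⟩
    [ y ≡ᵇ 0 ]· (ℚ.- ι⁺ d) ℚ.+ [ y ≡ᵇ e ]· ι⁺ (d + e) ℚ.+ [ e ≤ᵇ y ]· ι⁺ (d + y) ∎
    where
    is-d : (d + y ≡ᵇ d) ≡ (y ≡ᵇ 0)
    is-d = trans (cong (d + y ≡ᵇ_) (sym (+-identityʳ d))) (≡ᵇ-+ˡ d y 0)
    beyond : ((d + e <ᵇ d + y) ∧ (d + y ≤ᵇ B)) ≡ (e <ᵇ y)
    beyond = trans (cong₂ _∧_ (<ᵇ-+ˡ d e y) (dec-true (d + y ≤? B) (d+y≤B y<d))) (∧-identityʳ (e <ᵇ y))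

  private
    head≢ : ∀ {x} → 0 < x → (d + x ≡ᵇ dOf B) ≡ false
    head≢ {x} 0<x = dec-false (d + x ≟ dOf B) (>⇒≢ (subst (_< d + x) (sym dOfB≡d) (m<m+n d 0<x)))

    after-head : ∀ {x} → 0 < x → (dOf B <ᵇ d + x) ≡ true
    after-head {x} 0<x = dec-true (dOf B <? d + x) (subst (_< d + x) (sym dOfB≡d) (m<m+n d 0<x))

    d+r∸1≡ : dOf B + r ∸ 1 ≡ d + r′
    d+r∸1≡ = trans (cong (λ d₀ → d₀ + r ∸ 1) dOfB≡d) (+-∸-assoc d (s≤s z≤n))

  A-row-low : ∀ {x} j → 0 < x → x < r →
    A B r (d + x) j ≡ [ j ≡ᵇ d + x ]· (ℚ.- ι⁺ (d + x)) ℚ.+ [ j ≡ᵇ d + s x ]· ι⁺ (d + s x)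
  A-row-low {x} j 0<x x<r = begin
    A B r (d + x) j
      ≡⟨ trans (if-cong (head≢ 0<x)) (if-cong (cong₂ _∧_ (after-head 0<x) low)) ⟩
    (if j ≡ᵇ d + x then ι (ℤ.- (+ (d + x))) else if j ≡ᵇ target then ι⁺ target else 0ℚ)
      ≡⟨ two-entry-row j (<⇒≢ (subst (d + x <_) (sym target≡d+[x+e]) (+-monoʳ-< d (m<m+n x e>0)))) ⟩
    [ j ≡ᵇ d + x ]· (ℚ.- ι⁺ (d + x)) ℚ.+ [ j ≡ᵇ target ]· ι⁺ target
      ≡⟨ cong (λ k → [ j ≡ᵇ d + x ]· (ℚ.- ι⁺ (d + x)) ℚ.+ [ j ≡ᵇ k ]· ι⁺ k) target≡d+s[x] ⟩
    [ j ≡ᵇ d + x ]· (ℚ.- ι⁺ (d + x)) ℚ.+ [ j ≡ᵇ d + s x ]· ι⁺ (d + s x) ∎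
    where
    target = dOf B + (d + x) ∸ r
    low : (d + x ≤ᵇ dOf B + r ∸ 1) ≡ true
    low = dec-true (d + x ≤? dOf B + r ∸ 1) (subst (d + x ≤_) (sym d+r∸1≡) (+-monoʳ-≤ d (<⇒≤pred x<r)))
    target≡d+[x+e] : target ≡ d + (x + e)
    target≡d+[x+e] = begin
      dOf B + (d + x) ∸ r    ≡⟨ cong (λ d₀ → d₀ + (d + x) ∸ r) dOfB≡d ⟩
      r + e + (d + x) ∸ r    ≡⟨ cong (_∸ r) (+-assoc r e (d + x)) ⟩
      r + (e + (d + x)) ∸ r  ≡⟨ m+n∸m≡n r (e + (d + x)) ⟩
      e + (d + x)            ≡⟨ +-comm e (d + x) ⟩
      d + x + e              ≡⟨ +-assoc d x e ⟩
      d + (x + e)            ∎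
    target≡d+s[x] : target ≡ d + s x
    target≡d+s[x] = trans target≡d+[x+e] (cong (d ℕ.+_) (sym (s-low x<r)))

  A-row-high : ∀ {x} j → r ≤ x → x < d →
    A B r (d + x) j ≡ [ j ≡ᵇ d + x ]· (ℚ.- ι⁺ (d + x)) ℚ.+ [ j ≡ᵇ d + s x ]· ι⁺ (d + s x)
  A-row-high {x} j r≤x x<d = begin
    A B r (d + x) j
      ≡⟨ trans (if-cong (head≢ 0<x)) (trans (if-cong (cong₂ _∧_ (after-head 0<x) not-low)) (if-cong high)) ⟩
    (if j ≡ᵇ d + x then ι (ℤ.- (+ (d + x))) else if j ≡ᵇ target then ι⁺ target else 0ℚ)
      ≡⟨ two-entry-row j (>⇒≢ (subst (_< d + x) (sym target≡d+[x∸r]) (+-monoʳ-< d (∸-monoʳ-< {x} {r} (s≤s z≤n) r≤x)))) ⟩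
    [ j ≡ᵇ d + x ]· (ℚ.- ι⁺ (d + x)) ℚ.+ [ j ≡ᵇ target ]· ι⁺ target
      ≡⟨ cong (λ k → [ j ≡ᵇ d + x ]· (ℚ.- ι⁺ (d + x)) ℚ.+ [ j ≡ᵇ k ]· ι⁺ k) (trans target≡d+[x∸r] (cong (d ℕ.+_) (sym (s-high r≤x x<d)))) ⟩
    [ j ≡ᵇ d + x ]· (ℚ.- ι⁺ (d + x)) ℚ.+ [ j ≡ᵇ d + s x ]· ι⁺ (d + s x) ∎
    where
    target = d + x ∸ r
    target≡d+[x∸r] : target ≡ d + (x ∸ r)
    target≡d+[x∸r] = +-∸-assoc d r≤x
    0<x : 0 < x
    0<x = ≤-trans (s≤s z≤n) r≤x
    not-low : (d + x ≤ᵇ dOf B + r ∸ 1) ≡ false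
    not-low = dec-false (d + x ≤? dOf B + r ∸ 1) (<⇒≱ (subst (_< d + x) (sym d+r∸1≡) (+-monoʳ-< d r≤x)))
    high : ((dOf B + r ≤ᵇ d + x) ∧ (d + x ≤ᵇ B)) ≡ true
    high = cong₂ _∧_
      (dec-true (dOf B + r ≤? d + x) (subst (λ d₀ → d₀ + r ≤ d + x) (sym dOfB≡d) (+-monoʳ-≤ d r≤x)))
      (dec-true (d + x ≤? B) (d+y≤B x<d))

  A-row : ∀ {x} j → 0 < x → x < d →
    A B r (d + x) j ≡ [ j ≡ᵇ d + x ]· (ℚ.- ι⁺ (d + x)) ℚ.+ [ j ≡ᵇ d + s x ]· ι⁺ (d + s x)
  A-row {x} j 0<x x<d = [ A-row-low j 0<x , (λ x≮r → A-row-high j (≮⇒≥ x≮r) x<d) ]′ (toSum (x <? r))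

  ⟦_⟧ : ℕ → ℚ
  ⟦ x ⟧ = ι⁺ (d + x)

  M : ℕ → ℕ → ℚ
  M x y = A B r (d + x) (d + y)

  M-entry : ∀ {x y} → x < d → y < d →
    M x y ≡ [ y ≡ᵇ x ]· (ℚ.- ⟦ x ⟧) ℚ.+ [ y ≡ᵇ s x ]· ⟦ s x ⟧ ℚ.+ [ x ≡ᵇ 0 ]· ([ e ≤ᵇ y ]· ⟦ y ⟧)
  M-entry {zero} {y} _ y<d = begin
    A B r (d + 0) (d + y)
      ≡⟨ cong (λ i → A B r i (d + y)) (+-identityʳ d) ⟩
    A B r d (d + y)
      ≡⟨ A-head-row y<d ⟩
    [ y ≡ᵇ 0 ]· (ℚ.- ι⁺ d) ℚ.+ [ y ≡ᵇ e ]· ι⁺ (d + e) ℚ.+ [ e ≤ᵇ y ]· ⟦ y ⟧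
      ≡⟨ cong₂ (λ d′ e′ → [ y ≡ᵇ 0 ]· (ℚ.- ι⁺ d′) ℚ.+ [ y ≡ᵇ e′ ]· ι⁺ (d + e′) ℚ.+ [ e ≤ᵇ y ]· ⟦ y ⟧)
               (sym (+-identityʳ d)) (sym (s-low (s≤s z≤n))) ⟩
    [ y ≡ᵇ 0 ]· (ℚ.- ⟦ 0 ⟧) ℚ.+ [ y ≡ᵇ s 0 ]· ⟦ s 0 ⟧ ℚ.+ [ e ≤ᵇ y ]· ⟦ y ⟧ ∎
  M-entry {suc x} {y} x<d y<d = begin
    A B r (d + suc x) (d + y)
      ≡⟨ A-row (d + y) (s≤s z≤n) x<d ⟩
    [ d + y ≡ᵇ d + suc x ]· (ℚ.- ⟦ suc x ⟧) ℚ.+ [ d + y ≡ᵇ d + s (suc x) ]· ⟦ s (suc x) ⟧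
      ≡⟨ cong₂ (λ b c → [ b ]· (ℚ.- ⟦ suc x ⟧) ℚ.+ [ c ]· ⟦ s (suc x) ⟧) (≡ᵇ-+ˡ d y (suc x)) (≡ᵇ-+ˡ d y (s (suc x))) ⟩
    [ y ≡ᵇ suc x ]· (ℚ.- ⟦ suc x ⟧) ℚ.+ [ y ≡ᵇ s (suc x) ]· ⟦ s (suc x) ⟧
      ≡⟨ ℚP.+-identityʳ _ ⟨
    [ y ≡ᵇ suc x ]· (ℚ.- ⟦ suc x ⟧) ℚ.+ [ y ≡ᵇ s (suc x) ]· ⟦ s (suc x) ⟧ ℚ.+ 0ℚ ∎

  column-balance : ∀ {y} → y < d → ⟦ t y ⟧ ℚ.+ [ e ≤ᵇ y ]· ι⁺ d ≡ ⟦ y ⟧ ℚ.+ ι⁺ r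
  column-balance {y} y<d = [ above-e , below-e ]′ (toSum (e ≤? y))
    where
    below-e : ¬ e ≤ y → ⟦ t y ⟧ ℚ.+ [ e ≤ᵇ y ]· ι⁺ d ≡ ⟦ y ⟧ ℚ.+ ι⁺ r
    below-e e≰y = begin
      ⟦ t y ⟧ ℚ.+ [ e ≤ᵇ y ]· ι⁺ d  ≡⟨ cong (⟦ t y ⟧ ℚ.+_) (if-cong (dec-false (e ≤? y) e≰y)) ⟩
      ⟦ t y ⟧ ℚ.+ 0ℚ                ≡⟨ ℚP.+-identityʳ ⟦ t y ⟧ ⟩
      ι⁺ (d + t y)                  ≡⟨ cong (λ k → ι⁺ (d + k)) (t-low (≰⇒> e≰y)) ⟩
      ι⁺ (d + (y + r))              ≡⟨ cong ι⁺ (+-assoc d y r) ⟨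
      ι⁺ (d + y + r)                ≡⟨ ι⁺-+ (d + y) r ⟩
      ⟦ y ⟧ ℚ.+ ι⁺ r                ∎
    above-e : e ≤ y → ⟦ t y ⟧ ℚ.+ [ e ≤ᵇ y ]· ι⁺ d ≡ ⟦ y ⟧ ℚ.+ ι⁺ r
    above-e e≤y = begin
      ⟦ t y ⟧ ℚ.+ [ e ≤ᵇ y ]· ι⁺ d  ≡⟨ cong (⟦ t y ⟧ ℚ.+_) (if-cong (dec-true (e ≤? y) e≤y)) ⟩
      ⟦ t y ⟧ ℚ.+ ι⁺ d              ≡⟨ ι⁺-+ (d + t y) d ⟨
      ι⁺ (d + t y + d)              ≡⟨ cong ι⁺ d+t[y]+d≡d+y+r ⟩
      ι⁺ (d + y + r)                ≡⟨ ι⁺-+ (d + y) r ⟩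
      ⟦ y ⟧ ℚ.+ ι⁺ r                ∎
      where
      rearrange : ∀ a b c f → a + b + (c + f) ≡ a + (b + f) + c
      rearrange = solve-∀
      d+t[y]+d≡d+y+r : d + t y + d ≡ d + y + r
      d+t[y]+d≡d+y+r = begin
        d + t y + d            ≡⟨ cong (λ k → d + k + d) (t-high e≤y y<d) ⟩
        d + (y ∸ e) + (r + e)  ≡⟨ rearrange d (y ∸ e) r e ⟩
        d + (y ∸ e + e) + r    ≡⟨ cong (λ k → d + k + r) (m∸n+n≡m e≤y) ⟩
        d + y + r              ∎

  subgroup-indicator : ∀ {p} → InSubgroup p → ∀ g → sumOver subgroup (λ x → [ x ≡ᵇ p ]· g x) ≡ g p
  subgroup-indicator p∈ = sumOver-indicator subgroup-unique (∈-subgroup⁺ p∈)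

  ⟦⟧*M-entry : ∀ {x y} → x < d → y < d →
    ⟦ x ⟧ ℚ.* M x y ≡ [ x ≡ᵇ y ]· (⟦ x ⟧ ℚ.* ℚ.- ⟦ x ⟧) ℚ.+ [ x ≡ᵇ t y ]· (⟦ x ⟧ ℚ.* ⟦ s x ⟧)
                      ℚ.+ [ x ≡ᵇ 0 ]· (⟦ x ⟧ ℚ.* [ e ≤ᵇ y ]· ⟦ y ⟧)
  ⟦⟧*M-entry {x} {y} x<d y<d = begin
    ⟦ x ⟧ ℚ.* M x y
      ≡⟨ cong (⟦ x ⟧ ℚ.*_) (M-entry x<d y<d) ⟩
    ⟦ x ⟧ ℚ.* ([ y ≡ᵇ x ]· a₁ ℚ.+ [ y ≡ᵇ s x ]· a₂ ℚ.+ [ x ≡ᵇ 0 ]· a₃)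
      ≡⟨ solve 4 (λ c p q u → c :* (p :+ q :+ u) := c :* p :+ c :* q :+ c :* u) refl ⟦ x ⟧ _ _ _ ⟩
    ⟦ x ⟧ ℚ.* [ y ≡ᵇ x ]· a₁ ℚ.+ ⟦ x ⟧ ℚ.* [ y ≡ᵇ s x ]· a₂ ℚ.+ ⟦ x ⟧ ℚ.* [ x ≡ᵇ 0 ]· a₃
      ≡⟨ cong₂ ℚ._+_ (cong₂ ℚ._+_ ([]·-*ˡ ⟦ x ⟧ (y ≡ᵇ x) a₁) ([]·-*ˡ ⟦ x ⟧ (y ≡ᵇ s x) a₂)) ([]·-*ˡ ⟦ x ⟧ (x ≡ᵇ 0) a₃) ⟩
    [ y ≡ᵇ x ]· (⟦ x ⟧ ℚ.* a₁) ℚ.+ [ y ≡ᵇ s x ]· (⟦ x ⟧ ℚ.* a₂) ℚ.+ [ x ≡ᵇ 0 ]· (⟦ x ⟧ ℚ.* a₃)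
      ≡⟨ cong₂ (λ b c → [ b ]· (⟦ x ⟧ ℚ.* a₁) ℚ.+ [ c ]· (⟦ x ⟧ ℚ.* a₂) ℚ.+ [ x ≡ᵇ 0 ]· (⟦ x ⟧ ℚ.* a₃))
               (≡ᵇ-sym y x) (≡ᵇ-s-t x<d y<d) ⟩
    [ x ≡ᵇ y ]· (⟦ x ⟧ ℚ.* a₁) ℚ.+ [ x ≡ᵇ t y ]· (⟦ x ⟧ ℚ.* a₂) ℚ.+ [ x ≡ᵇ 0 ]· (⟦ x ⟧ ℚ.* a₃) ∎
    where
    a₁ = ℚ.- ⟦ x ⟧
    a₂ = ⟦ s x ⟧
    a₃ = [ e ≤ᵇ y ]· ⟦ y ⟧

  column : ∀ {y} → InSubgroup y → sumOver subgroup (λ x → ⟦ x ⟧ ℚ.* M x y) ≡ ι⁺ r ℚ.* ⟦ y ⟧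
  column {y} y∈ = begin
    sumOver subgroup (λ x → ⟦ x ⟧ ℚ.* M x y)
      ≡⟨ sumOver-cong subgroup (λ x x∈ → ⟦⟧*M-entry (InSubgroup⇒< (∈-subgroup⁻ x∈)) y<d) ⟩
    sumOver subgroup (λ x → f₁ x ℚ.+ f₂ x ℚ.+ f₃ x)
      ≡⟨ trans (sumOver-+ subgroup (λ x → f₁ x ℚ.+ f₂ x) f₃) (cong (ℚ._+ sumOver subgroup f₃) (sumOver-+ subgroup f₁ f₂)) ⟩
    sumOver subgroup f₁ ℚ.+ sumOver subgroup f₂ ℚ.+ sumOver subgroup f₃
      ≡⟨ cong₂ ℚ._+_ (cong₂ ℚ._+_ (subgroup-indicator y∈ g₁) (subgroup-indicator (InSubgroup-t y∈) g₂)) (subgroup-indicator InSubgroup-0 g₃) ⟩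
    g₁ y ℚ.+ g₂ (t y) ℚ.+ g₃ 0
      ≡⟨ cong₂ (λ z k → g₁ y ℚ.+ ⟦ t y ⟧ ℚ.* ⟦ z ⟧ ℚ.+ ι⁺ k ℚ.* [ e ≤ᵇ y ]· ⟦ y ⟧) (s∘t y<d) (+-identityʳ d) ⟩
    g₁ y ℚ.+ ⟦ t y ⟧ ℚ.* ⟦ y ⟧ ℚ.+ ι⁺ d ℚ.* [ e ≤ᵇ y ]· ⟦ y ⟧
      ≡⟨ cong (g₁ y ℚ.+ ⟦ t y ⟧ ℚ.* ⟦ y ⟧ ℚ.+_) (trans ([]·-*ˡ (ι⁺ d) (e ≤ᵇ y) ⟦ y ⟧) (sym ([]·-*ʳ (e ≤ᵇ y) (ι⁺ d) ⟦ y ⟧))) ⟩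
    g₁ y ℚ.+ ⟦ t y ⟧ ℚ.* ⟦ y ⟧ ℚ.+ [ e ≤ᵇ y ]· ι⁺ d ℚ.* ⟦ y ⟧
      ≡⟨ eigen-balance ⟦ y ⟧ ⟦ t y ⟧ ([ e ≤ᵇ y ]· ι⁺ d) (ι⁺ r) (column-balance y<d) ⟩
    ι⁺ r ℚ.* ⟦ y ⟧ ∎
    where
    y<d = InSubgroup⇒< y∈
    g₁ g₂ g₃ f₁ f₂ f₃ : ℕ → ℚ
    g₁ x = ⟦ x ⟧ ℚ.* ℚ.- ⟦ x ⟧
    g₂ x = ⟦ x ⟧ ℚ.* ⟦ s x ⟧
    g₃ x = ⟦ x ⟧ ℚ.* [ e ≤ᵇ y ]· ⟦ y ⟧
    f₁ x = [ x ≡ᵇ y ]· g₁ x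
    f₂ x = [ x ≡ᵇ t y ]· g₂ x
    f₃ x = [ x ≡ᵇ 0 ]· g₃ x

  left-eigenvector : IsPosLeftEigenvector subgroup M (ι⁺ r) ⟦_⟧
  left-eigenvector = (λ x _ → ι⁺-pos (r′ + e + x)) , (λ y y∈ → column {y} (∈-subgroup⁻ y∈))

  open Walk s (λ x → (⟦ s x ⟧ ÷ ι⁺ (d + x + r)) {{ι⁺-nonZero (r′ + e + x + r)}})

  v : ℕ → ℚ
  v = walk d

  v-step : ∀ {x} → InSubgroup x → x ≢ 0 → ι⁺ (d + x + r) ℚ.* v x ≡ ⟦ s x ⟧ ℚ.* v (s x)
  v-step (n , n<d , refl) x≢0 = begin
    ι⁺ (d + x + r) ℚ.* v x
      ≡⟨ cong (ι⁺ (d + x + r) ℚ.*_) (walk-step n x≢0 (iterate-s-multiple n) (<⇒≤ n<d)) ⟩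
    ι⁺ (d + x + r) ℚ.* ((⟦ s x ⟧ ÷ ι⁺ (d + x + r)) {{ι⁺-nonZero (r′ + e + x + r)}} ℚ.* v (s x))
      ≡⟨ *-÷-cancel ⟦ s x ⟧ (ι⁺ (d + x + r)) (v (s x)) {{ι⁺-nonZero (r′ + e + x + r)}} ⟩
    ⟦ s x ⟧ ℚ.* v (s x) ∎
    where x = multiple n

  M*v-entry : ∀ {x y} → x < d → y < d → x ≢ 0 →
    M x y ℚ.* v y ≡ [ y ≡ᵇ x ]· (ℚ.- ⟦ x ⟧ ℚ.* v y) ℚ.+ [ y ≡ᵇ s x ]· (⟦ s x ⟧ ℚ.* v y)
  M*v-entry {x} {y} x<d y<d x≢0 = begin
    M x y ℚ.* v y
      ≡⟨ cong (ℚ._* v y) (M-entry x<d y<d) ⟩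
    (a₁ ℚ.+ a₂ ℚ.+ [ x ≡ᵇ 0 ]· ([ e ≤ᵇ y ]· ⟦ y ⟧)) ℚ.* v y
      ≡⟨ cong (λ a₃ → (a₁ ℚ.+ a₂ ℚ.+ a₃) ℚ.* v y) (if-cong (dec-false (x ≟ 0) x≢0)) ⟩
    (a₁ ℚ.+ a₂ ℚ.+ 0ℚ) ℚ.* v y
      ≡⟨ cong (ℚ._* v y) (ℚP.+-identityʳ (a₁ ℚ.+ a₂)) ⟩
    (a₁ ℚ.+ a₂) ℚ.* v y
      ≡⟨ ℚP.*-distribʳ-+ (v y) a₁ a₂ ⟩
    a₁ ℚ.* v y ℚ.+ a₂ ℚ.* v y
      ≡⟨ cong₂ ℚ._+_ ([]·-*ʳ (y ≡ᵇ x) (ℚ.- ⟦ x ⟧) (v y)) ([]·-*ʳ (y ≡ᵇ s x) ⟦ s x ⟧ (v y)) ⟩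
    [ y ≡ᵇ x ]· (ℚ.- ⟦ x ⟧ ℚ.* v y) ℚ.+ [ y ≡ᵇ s x ]· (⟦ s x ⟧ ℚ.* v y) ∎
    where
    a₁ = [ y ≡ᵇ x ]· (ℚ.- ⟦ x ⟧)
    a₂ = [ y ≡ᵇ s x ]· ⟦ s x ⟧

  row : ∀ {x} → InSubgroup x → x ≢ 0 → sumOver subgroup (λ y → M x y ℚ.* v y) ≡ ι⁺ r ℚ.* v x
  row {x} x∈ x≢0 = begin
    sumOver subgroup (λ y → M x y ℚ.* v y)
      ≡⟨ sumOver-cong subgroup (λ y y∈ → M*v-entry x<d (InSubgroup⇒< (∈-subgroup⁻ y∈)) x≢0) ⟩
    sumOver subgroup (λ y → [ y ≡ᵇ x ]· h₁ y ℚ.+ [ y ≡ᵇ s x ]· h₂ y)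
      ≡⟨ sumOver-+ subgroup (λ y → [ y ≡ᵇ x ]· h₁ y) (λ y → [ y ≡ᵇ s x ]· h₂ y) ⟩
    sumOver subgroup (λ y → [ y ≡ᵇ x ]· h₁ y) ℚ.+ sumOver subgroup (λ y → [ y ≡ᵇ s x ]· h₂ y)
      ≡⟨ cong₂ ℚ._+_ (subgroup-indicator x∈ h₁) (subgroup-indicator (InSubgroup-s x∈) h₂) ⟩
    ℚ.- ⟦ x ⟧ ℚ.* v x ℚ.+ ⟦ s x ⟧ ℚ.* v (s x)
      ≡⟨ cong (ℚ.- ⟦ x ⟧ ℚ.* v x ℚ.+_) (sym (v-step x∈ x≢0)) ⟩
    ℚ.- ⟦ x ⟧ ℚ.* v x ℚ.+ ι⁺ (d + x + r) ℚ.* v x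
      ≡⟨ cong (λ q → ℚ.- ⟦ x ⟧ ℚ.* v x ℚ.+ q ℚ.* v x) (ι⁺-+ (d + x) r) ⟩
    ℚ.- ⟦ x ⟧ ℚ.* v x ℚ.+ (⟦ x ⟧ ℚ.+ ι⁺ r) ℚ.* v x
      ≡⟨ solve 3 (λ a ρ w → (:- a) :* w :+ (a :+ ρ) :* w := ρ :* w) refl ⟦ x ⟧ (ι⁺ r) (v x) ⟩
    ι⁺ r ℚ.* v x ∎
    where
    x<d = InSubgroup⇒< x∈
    h₁ h₂ : ℕ → ℚ
    h₁ y = ℚ.- ⟦ x ⟧ ℚ.* v y
    h₂ y = ⟦ s x ⟧ ℚ.* v y

  right-eigenvector : IsEigenvalue subgroup M (ι⁺ r)
  right-eigenvector = v , (0 , 0∈ , λ ()) , rows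
    where
    0∈ = ∈-subgroup⁺ InSubgroup-0
    row-0 : sumOver subgroup (λ y → M 0 y ℚ.* v y) ≡ ι⁺ r ℚ.* v 0
    row-0 = eigen-row-from-left-eigenvector subgroup-unique 0∈ {M = M} {ι⁺ r} {⟦_⟧} {v} {{ι⁺-nonZero (r′ + e + 0)}}
              (proj₂ left-eigenvector) (λ x x∈ x≢0 → row (∈-subgroup⁻ x∈) x≢0)
    rows : ∀ x → x ∈ subgroup → sumOver subgroup (λ y → M x y ℚ.* v y) ≡ ι⁺ r ℚ.* v x
    rows x x∈ = [ (λ x≡0 → subst (λ x → sumOver subgroup (λ y → M x y ℚ.* v y) ≡ ι⁺ r ℚ.* v x) (sym x≡0) row-0)
                , row (∈-subgroup⁻ x∈) ]′ (toSum (x ≟ 0))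

  eigen-on-Sidx : IsEigenvalue (Sidx B r) (A B r) (ι⁺ r) × Σ (ℕ → ℚ) (IsPosLeftEigenvector (Sidx B r) (A B r) (ι⁺ r))
  eigen-on-Sidx =
    subst (λ I → IsEigenvalue I (A B r) (ι⁺ r) × Σ (ℕ → ℚ) (IsPosLeftEigenvector I (A B r) (ι⁺ r)))
          (sym (Sidx≡ {B} {r} dOfB≡d))
          ( IsEigenvalue-shift d {subgroup} {A B r} {ι⁺ r} right-eigenvector
          , (λ i → ⟦ i ∸ d ⟧) , IsPosLeftEigenvector-shift d {subgroup} {A B r} {ι⁺ r} left-eigenvector)

lemma5 : (B r : ℕ) → (Σ ℕ λ k → B ≡ suc (2 * k)) → 3 ≤ B → 1 ≤ r → 2 * r < B →
    IsEigenvalue (Sidx B r) (A B r) (ι (+ r)) ×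
    Σ (ℕ → ℚ) (λ w → IsPosLeftEigenvector (Sidx B r) (A B r) (ι (+ r)) w)
-- The hypothesis 3 ≤ B follows from 1 ≤ r and 2r < B.
lemma5 B (suc r′) (k , refl) _ (s≤s z≤n) 2r<B = eigen-on-Sidx
  where
  r′<k : r′ < k
  r′<k = *-cancelˡ-≤ 2 (≤-pred 2r<B)
  2+2k≡[1+k]+[1+k] : ∀ k → suc (suc (2 * k)) ≡ suc k + suc k
  2+2k≡[1+k]+[1+k] = solve-∀
  open Submatrix B r′ (k ∸ r′) (m<n⇒0<n∸m r′<k)
    (trans (2+2k≡[1+k]+[1+k] k) (cong (λ n → suc n + suc n) (sym (m+[n∸m]≡n (<⇒≤ r′<k)))))
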